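{- Fix $\sigma\ge 2$ and let $w$ be large enough that $d=\lfloor\log_\sigma(w/\ln w)\rfloor-1\ge 1$. Let $\mathcal{F}_{\sigma,w}\subseteq\Sigma^w$ be the set of $w$-mers $x$ such that either $0^d$ is a prefix of $x$, or $0^d$ is not a substring of $x$. Then the maximum number of vertices of a walk in the de Bruijn graph of order $w$ containing no vertex of $\mathcal{F}_{\sigma,w}$ is exactly $w-d$.
   Context: $\Sigma=\{0,\dots,\sigma-1\}$; $0^d$ denotes the string of $d$ zeros. The de Bruijn graph of order $w$ has vertex set $\Sigma^w$ and an edge $(u,v)$ for every string of length $w+1$ with prefix $u$ and suffix $v$; a walk is a sequence of (not necessarily distinct) vertices with an edge from each to the next. -}

module Defs where

open import Data.Nat using (ℕ; zero; suc; _+_; _*_; _^_; _≤_; _<_; s≤s; z≤n; _!)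

open import Data.Fin using (Fin; zero)
open import Data.Vec using (Vec; init; tail; toList)
open import Data.List using (List; replicate; _++_)
open import Data.List.Relation.Unary.Linked using (Linked)
open import Data.Product using (Σ; ∃; ∃-syntax; _×_)
open import Data.Sum using (_⊎_)
open import Relation.Nullary using (¬_)
open import Relation.Binary.PropositionalEquality using (_≡_)

-- Exponential function, via exact integer arithmetic.
-- S n w = Σ_{k ≤ n} w^k / k!  is the n-th partial sum of e^w.
-- T n w = n! · S n w  = Σ_{k ≤ n} w^k · n!/k!  (a natural number).

T : ℕ → ℕ → ℕ
T zero    w = 1
T (suc n) w = suc n * T n w + w ^ suc n

-- a ≤ e^w  (for w ≥ 1, e^w is irrational, so this is a < e^w,
-- i.e. some partial sum exceeds a)
_≤exp_ : ℕ → ℕ → Set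
a ≤exp w = ∃[ n ] (a * (n !) < T n w)

-- e^w < b  (equivalently e^w ≤ b, as e^w is not an integer for w ≥ 1:
-- every partial sum is at most b)
exp_<_ : ℕ → ℕ → Set
exp w < b = ∀ n → T n w ≤ b * (n !)

-- FloorLogRatio σ w k  :⇔  k = ⌊ log_σ (w / ln w) ⌋   (for w ≥ 2)
-- i.e.  σ^k ≤ w / ln w < σ^(k+1)
-- ⇔    w^(σ^k) ≤ e^w  and  e^w < w^(σ^(k+1)).
FloorLogRatio : ℕ → ℕ → ℕ → Set
FloorLogRatio σ w k = (w ^ (σ ^ k)) ≤exp w × exp w < (w ^ (σ ^ suc k))

zeroSym : ∀ {σ} → 2 ≤ σ → Fin σ
zeroSym (s≤s _) = zero

Kmer : ℕ → ℕ → Set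
Kmer σ w = Vec (Fin σ) w

Edge : ∀ {σ w} → Kmer σ w → Kmer σ w → Set
Edge {σ} {w} u v = Σ (Vec (Fin σ) (suc w)) λ s → (init s ≡ u) × (tail s ≡ v)

IsWalk : ∀ {σ w} → List (Kmer σ w) → Set
IsWalk = Linked Edge

IsPrefixOf : ∀ {A : Set} → List A → List A → Set
IsPrefixOf u x = ∃[ zs ] (u ++ zs ≡ x)

IsSubstringOf : ∀ {A : Set} → List A → List A → Set
IsSubstringOf u x = ∃[ ys ] ∃[ zs ] (ys ++ u ++ zs ≡ x)

InF : ∀ {σ w} → 2 ≤ σ → ℕ → Kmer σ w → Set
InF hσ d x = IsPrefixOf (replicate d (zeroSym hσ)) (toList x)
           ⊎ ¬ IsSubstringOf (replicate d (zeroSym hσ)) (toList x)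

{-# OPTIONS --safe #-}
module Submission where

-- Each edge of the de Bruijn graph deletes the first letter of a w-mer and appends one, so an
-- occurrence of 0ᵈ at offset i in the first vertex of a walk sits at offset i ∸ j in the j-th
-- vertex. A walk avoiding F starts with a w-mer containing 0ᵈ at some offset i ≤ w ∸ d, and
-- the occurrence would become a prefix after i steps, so the walk has at most w ∸ d vertices.
-- Conversely, starting from 1^(w∸d) 0ᵈ and always appending 1 gives w ∸ d vertices, each
-- beginning with 1 and containing 0ᵈ.

open import Defs
open import Data.Nat using (ℕ; zero; suc; _+_; _∸_; _≤_; s≤s; z≤n; _≤?_)
open import Data.Nat.Properties
  using (≤-trans; m≤m+n; +-assoc; m+n≤o⇒m≤o∸n; m∸n+n≡m; m≤n⇒m∸n≡0; ≰⇒≥; module ≤-Reasoning)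
open import Data.Fin using (Fin; zero; suc)
open import Data.Vec as Vec using (Vec; []; _∷_; _∷ʳ_; init; last; initLast; toList)
open import Data.Vec.Properties using (init-∷ʳ; toList-∷ʳ; toList-++; toList-replicate; length-toList)
open import Data.List as List using (List; []; _∷_; [_]; _++_; length; replicate; iterate)
open import Data.List.Properties
  using (++-assoc; ++-identityʳ; length-++; length-replicate; length-iterate; ∷-injectiveˡ; ∷-injectiveʳ)
open import Data.List.Relation.Unary.All as All using (All; []; _∷_)
open import Data.List.Relation.Unary.Linked using (Linked; []; [-]; _∷_)
open import Data.Product using (Σ; _×_; _,_)
open import Data.Sum using (inj₁; inj₂)
open import Function using (_∘_)
open import Relation.Nullary using (¬_; yes; no; contradiction)
open import Relation.Nullary.Decidable using (decidable-stable)
open import Relation.Binary.PropositionalEquality using (_≡_; _≢_; refl; sym; trans; cong; cong₂; subst; module ≡-Reasoning)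

private
  variable
    A : Set
    σ w : ℕ

zeros : 2 ≤ σ → ℕ → List (Fin σ)
zeros hσ d = replicate d (zeroSym hσ)

FAvoidingWalk : 2 ≤ σ → (d w n : ℕ) → Set
FAvoidingWalk {σ} hσ d w n =
  Σ (List (Kmer σ w)) (λ p → IsWalk p × All (λ x → ¬ InF hσ d x) p × length p ≡ n)

IsPrefixOf-head : ∀ {a b : A} {u v l} → IsPrefixOf (a ∷ u) l → IsPrefixOf (b ∷ v) l → a ≡ b
IsPrefixOf-head (_ , refl) (_ , eq) = sym (∷-injectiveˡ eq)

IsPrefixOf⇒IsSubstringOf : ∀ (ys : List A) {u l} → IsPrefixOf (ys ++ u) l → IsSubstringOf u l
IsPrefixOf⇒IsSubstringOf ys {u} (zs , refl) = ys , zs , sym (++-assoc ys u zs)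

toList-init-++-last : ∀ {n} (s : Vec A (suc n)) → toList (init s) ++ [ last s ] ≡ toList s
toList-init-++-last s with initLast s
... | _ , _ , s≡ys∷ʳy = trans (sym (toList-∷ʳ _ _)) (cong toList (sym s≡ys∷ʳy))

edge-shifts-prefix : ∀ {x y : Kmer σ w} {b u} → Edge x y → IsPrefixOf (b ∷ u) (toList x) → IsPrefixOf u (toList y)
edge-shifts-prefix {b = b} {u} (s₀ ∷ s , refl , refl) (zs , b∷u++zs≡x) =
  zs ++ [ last (s₀ ∷ s) ] , ∷-injectiveʳ (begin
    b ∷ u ++ zs ++ [ last (s₀ ∷ s) ]             ≡⟨ sym (++-assoc (b ∷ u) zs _) ⟩
    (b ∷ u ++ zs) ++ [ last (s₀ ∷ s) ]           ≡⟨ cong (_++ [ last (s₀ ∷ s) ]) b∷u++zs≡x ⟩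
    toList (init (s₀ ∷ s)) ++ [ last (s₀ ∷ s) ]  ≡⟨ toList-init-++-last (s₀ ∷ s) ⟩
    s₀ ∷ toList s                                ∎)
  where open ≡-Reasoning

walk-length≤offset : ∀ {u} (ys : List (Fin σ)) {x : Kmer σ w} {p} → IsWalk (x ∷ p) →
  All (λ y → ¬ IsPrefixOf u (toList y)) (x ∷ p) → IsPrefixOf (ys ++ u) (toList x) →
  length (x ∷ p) ≤ length ys
walk-length≤offset []       _            (x∌u ∷ _) u≼x = contradiction u≼x x∌u
walk-length≤offset (_ ∷ ys) {p = []}    _            _           _   = s≤s z≤n
walk-length≤offset (_ ∷ ys) {p = _ ∷ _} (edge ∷ walk) (_ ∷ avoid) pre =
  s≤s (walk-length≤offset ys walk avoid (edge-shifts-prefix edge pre))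

offset≤length∸length : ∀ (ys u zs : List A) {x : Vec A w} → ys ++ u ++ zs ≡ toList x →
  length ys ≤ w ∸ length u
offset≤length∸length {w = w} ys u zs {x} eq = m+n≤o⇒m≤o∸n (length ys) (begin
  length ys + length u                ≤⟨ m≤m+n _ (length zs) ⟩
  length ys + length u + length zs    ≡⟨ +-assoc (length ys) _ _ ⟩
  length ys + (length u + length zs)  ≡⟨ cong (length ys +_) (sym (length-++ u)) ⟩
  length ys + length (u ++ zs)        ≡⟨ sym (length-++ ys) ⟩
  length (ys ++ u ++ zs)              ≡⟨ cong length eq ⟩
  length (toList x)                   ≡⟨ length-toList x ⟩
  w                                   ∎)
  where open ≤-Reasoning

F-avoiding-walk-length≤ : (hσ : 2 ≤ σ) (d : ℕ) (p : List (Kmer σ w)) → IsWalk p →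
  All (λ x → ¬ InF hσ d x) p → length p ≤ w ∸ d
F-avoiding-walk-length≤ hσ d [] _ _ = z≤n
F-avoiding-walk-length≤ {w = w} hσ d (x ∷ p) walk avoid@(x∉F ∷ _) =
  -- ¬ InF hσ d x only refutes the absence of 0ᵈ in x; the goal is decidable, so an occurrence may be used.
  decidable-stable (length (x ∷ p) ≤? w ∸ d) λ too-long →
    x∉F (inj₂ λ (ys , zs , eq) → too-long (≤-trans
      (walk-length≤offset ys walk (All.map (_∘ inj₁) avoid) (zs , trans (++-assoc ys (zeros hσ d) zs) eq))
      (subst (λ n → length ys ≤ w ∸ n) (length-replicate d) (offset≤length∸length ys (zeros hσ d) zs eq))))

shiftIn : A → Vec A w → Vec A w
shiftIn a []       = []
shiftIn a (_ ∷ xs) = xs ∷ʳ a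

edge-shiftIn : ∀ (a : Fin σ) (x : Kmer σ w) → Edge x (shiftIn a x)
edge-shiftIn a []       = Vec.[ a ] , refl , refl
edge-shiftIn a (x ∷ xs) = (x ∷ xs) ∷ʳ a , init-∷ʳ a (x ∷ xs) , refl

iterate-Linked : ∀ {R : A → A → Set} {f : A → A} → (∀ x → R x (f x)) → ∀ x n → Linked R (iterate f x n)
iterate-Linked r x zero          = []
iterate-Linked r x (suc zero)    = [-]
iterate-Linked r x (suc (suc n)) = r x ∷ iterate-Linked r _ (suc n)

oneSym : 2 ≤ σ → Fin σ
oneSym (s≤s (s≤s _)) = suc zero

oneSym≢zeroSym : (hσ : 2 ≤ σ) → oneSym hσ ≢ zeroSym hσ
oneSym≢zeroSym (s≤s (s≤s _)) ()

∉F-if-prefix : (hσ : 2 ≤ σ) {d : ℕ} → 1 ≤ d → ∀ {o} → o ≢ zeroSym hσ → ∀ ys {x : Kmer σ w} →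
  IsPrefixOf (o ∷ ys ++ zeros hσ d) (toList x) → ¬ InF hσ d x
∉F-if-prefix hσ (s≤s _)     o≢0 ys o∷ys++0ᵈ≼x (inj₁ 0ᵈ≼x) = o≢0 (IsPrefixOf-head o∷ys++0ᵈ≼x 0ᵈ≼x)
∉F-if-prefix hσ _       {o} _   ys o∷ys++0ᵈ≼x (inj₂ 0ᵈ⋢x) = 0ᵈ⋢x (IsPrefixOf⇒IsSubstringOf (o ∷ ys) o∷ys++0ᵈ≼x)

module _ (hσ : 2 ≤ σ) {d : ℕ} (1≤d : 1 ≤ d) {o : Fin σ} (o≢0 : o ≢ zeroSym hσ) where

  iterate-shiftIn-avoids-F : ∀ (a : Fin σ) n {x : Kmer σ w} → IsPrefixOf (replicate n o ++ zeros hσ d) (toList x) →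
    All (λ y → ¬ InF hσ d y) (iterate (shiftIn a) x n)
  iterate-shiftIn-avoids-F a zero    _   = []
  iterate-shiftIn-avoids-F a (suc n) {x} pre =
    ∉F-if-prefix hσ 1≤d o≢0 (replicate n o) pre ∷
    iterate-shiftIn-avoids-F a n (edge-shifts-prefix (edge-shiftIn a x) pre)

  F-avoiding-walk-of-length : ∀ k → FAvoidingWalk hσ d (k + d) k
  F-avoiding-walk-of-length k =
    iterate (shiftIn o) x₀ k , iterate-Linked (edge-shiftIn o) x₀ k ,
    iterate-shiftIn-avoids-F o k ([] , x₀-toList) , length-iterate (shiftIn o) x₀ k
    where
    x₀ : Kmer σ (k + d)
    x₀ = Vec.replicate k o Vec.++ Vec.replicate d (zeroSym hσ)

    x₀-toList : (replicate k o ++ zeros hσ d) ++ [] ≡ toList x₀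
    x₀-toList = begin
      (replicate k o ++ zeros hσ d) ++ []  ≡⟨ ++-identityʳ _ ⟩
      replicate k o ++ zeros hσ d          ≡⟨ sym (cong₂ _++_ (toList-replicate k o) (toList-replicate d _)) ⟩
      toList (Vec.replicate k o) ++ toList (Vec.replicate d (zeroSym hσ))
                                           ≡⟨ sym (toList-++ (Vec.replicate k o) _) ⟩
      toList x₀                            ∎
      where open ≡-Reasoning

F-avoiding-walk-of-length-w∸d : (hσ : 2 ≤ σ) (w : ℕ) {d : ℕ} → 1 ≤ d → FAvoidingWalk hσ d w (w ∸ d)
F-avoiding-walk-of-length-w∸d hσ w {d} 1≤d with d ≤? w
... | no  d≰w = [] , [] , [] , sym (m≤n⇒m∸n≡0 (≰⇒≥ d≰w))
... | yes d≤w = subst (λ m → FAvoidingWalk hσ d m (w ∸ d)) (m∸n+n≡m d≤w)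
                  (F-avoiding-walk-of-length hσ 1≤d (oneSym≢zeroSym hσ) (w ∸ d))

lemma2 : (σ : ℕ) (hσ : 2 ≤ σ) (w d : ℕ) → 2 ≤ w → FloorLogRatio σ w (suc d) → 1 ≤ d →
    Σ (List (Kmer σ w)) (λ p → IsWalk p × All (λ x → ¬ InF hσ d x) p × length p ≡ w ∸ d)
    × ((p : List (Kmer σ w)) → IsWalk p → All (λ x → ¬ InF hσ d x) p → length p ≤ w ∸ d)
lemma2 σ hσ w d _ _ 1≤d = F-avoiding-walk-of-length-w∸d hσ w 1≤d , F-avoiding-walk-length≤ hσ d
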